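{- Let $F_0=0$, $F_1=1$ and $F_n=F_{n-1}+F_{n-2}$ for $n\ge 2$ be the Fibonacci numbers. For integers $a,k\ge 0$ let $P(a,k)=2\binom{a+1}{k}-\binom{a}{k}$, and let $Q(k)=\sum_{0\le i<k}P(2k-i,\,i+1)$. Then for every integer $k\ge 0$, $$Q(k)=F_{2k+2}+2F_{2k+1}-3.$$ -}

module Defs where

open import Data.Nat using (ℕ; zero; suc; _*_)
import Data.Nat as ℕ
open import Data.Nat.Combinatorics using (_C_)
open import Data.Integer using (ℤ; +_; _-_; _+_)
open import Data.List using (List; map; upTo)
import Data.List as List

fib : ℕ → ℕ
fib zero = 0
fib (suc zero) = 1
fib (suc (suc n)) = fib (suc n) ℕ.+ fib n

-- P(a,k) = 2 * C(a+1,k) - C(a,k), computed in ℤ (no truncation)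
P : ℕ → ℕ → ℤ
P a k = + (2 * ((suc a) C k)) - + (a C k)

sumℤ : List ℤ → ℤ
sumℤ = List.foldr _+_ (+ 0)

Q : ℕ → ℤ
Q k = sumℤ (map (λ i → P ((2 * k) ℕ.∸ i) (suc i)) (upTo k))

-- The shallow diagonals of Pascal's triangle sum to Fibonacci numbers:
-- Σ_r C(n − r, r) = F(n+1). Splitting P, Q k = 2 S₁ − S₂ where
-- S₁ = Σ_{i<k} C(2k+1−i, i+1) and S₂ = Σ_{i<k} C(2k−i, i+1) are the diagonals
-- n = 2k+2 and n = 2k+1 with their two end terms removed; these ends are 1, 1
-- and 1, 0 respectively, so S₁ = F(2k+3) − 2, S₂ = F(2k+2) − 1, and
-- 2 S₁ − S₂ = F(2k+2) + 2 F(2k+1) − 3 by the Fibonacci recurrence.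
{-# OPTIONS --safe #-}
module Submission where

open import Defs
open import Data.Nat using (ℕ; zero; suc; _*_; _∸_; _≤_; _<_; z≤n; s≤s; z<s; s<s)
import Data.Nat as ℕ
open import Data.Nat.Properties
  using (+-comm; +-assoc; +-suc; +-identityʳ; *-zeroʳ; *-distribˡ-+; +-∸-assoc; m+n∸n≡m;
         m≤n⇒m≤1+n; n≤1+n; n<1+n; <⇒≤; ≤-trans; m≤m+n; suc-injective; +-commutativeSemigroup)
open import Data.Nat.ListAction using (sum)
open import Data.Nat.ListAction.Properties using (sum-++)
open import Data.Nat.Combinatorics using (_C_; nCk+nC[k+1]≡[n+1]C[k+1]; nCn≡1; k>n⇒nCk≡0)
open import Data.Integer using (ℤ; +_; _-_; _+_)
open import Data.Integer.Properties using (pos-+)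
open import Data.List using ([]; _∷_; [_]; _++_; map; upTo; applyUpTo)
open import Data.List.Properties using (applyUpTo-∷ʳ; map-upTo)
open import Algebra.Properties.CommutativeSemigroup +-commutativeSemigroup using (interchange)
open import Relation.Binary.PropositionalEquality using (_≡_; refl; sym; trans; cong; cong₂; module ≡-Reasoning)
import Data.Nat.Tactic.RingSolver as ℕ-Solver
import Data.Integer.Tactic.RingSolver as ℤ-Solver

sum-map-*ˡ : ∀ {A : Set} c (f : A → ℕ) xs → sum (map (λ x → c * f x) xs) ≡ c * sum (map f xs)
sum-map-*ˡ c f []       = sym (*-zeroʳ c)
sum-map-*ˡ c f (x ∷ xs) =
  trans (cong (c * f x ℕ.+_) (sum-map-*ˡ c f xs)) (sym (*-distribˡ-+ c (f x) (sum (map f xs))))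

sum-applyUpTo-suc : ∀ (f : ℕ → ℕ) n → sum (applyUpTo f (suc n)) ≡ sum (applyUpTo f n) ℕ.+ f n
sum-applyUpTo-suc f n = begin
  sum (applyUpTo f (suc n))          ≡⟨ cong sum (applyUpTo-∷ʳ f n) ⟨
  sum (applyUpTo f n ++ [ f n ])     ≡⟨ sum-++ (applyUpTo f n) [ f n ] ⟩
  sum (applyUpTo f n) ℕ.+ (f n ℕ.+ 0) ≡⟨ cong (sum (applyUpTo f n) ℕ.+_) (+-identityʳ (f n)) ⟩
  sum (applyUpTo f n) ℕ.+ f n        ∎
  where open ≡-Reasoning

sum-applyUpTo-cong : ∀ {f g : ℕ → ℕ} n → (∀ {i} → i < n → f i ≡ g i) →
                     sum (applyUpTo f n) ≡ sum (applyUpTo g n)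
sum-applyUpTo-cong zero    f≗g = refl
sum-applyUpTo-cong (suc n) f≗g = cong₂ ℕ._+_ (f≗g z<s) (sum-applyUpTo-cong n (λ i<n → f≗g (s<s i<n)))

sumℤ-map-difference : ∀ {A : Set} (f g : A → ℕ) xs →
  sumℤ (map (λ x → + f x - + g x) xs) ≡ + sum (map f xs) - + sum (map g xs)
sumℤ-map-difference f g []       = refl
sumℤ-map-difference f g (x ∷ xs) = begin
  (+ f x - + g x) + sumℤ (map (λ x → + f x - + g x) xs)
    ≡⟨ cong (λ s → (+ f x - + g x) + s) (sumℤ-map-difference f g xs) ⟩
  (+ f x - + g x) + (+ Σf - + Σg)
    ≡⟨ regroup (+ f x) (+ g x) (+ Σf) (+ Σg) ⟩
  (+ f x + + Σf) - (+ g x + + Σg)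
    ≡⟨ cong₂ _-_ (pos-+ (f x) Σf) (pos-+ (g x) Σg) ⟨
  + (f x ℕ.+ Σf) - + (g x ℕ.+ Σg)
    ∎
  where
  open ≡-Reasoning
  Σf = sum (map f xs)
  Σg = sum (map g xs)
  regroup : ∀ (a b c d : ℤ) → (a - b) + (c - d) ≡ (a + c) - (b + d)
  regroup = ℤ-Solver.solve-∀

[+m]-[+n]≡[+p]-[+q] : ∀ m n p q → m ℕ.+ q ≡ p ℕ.+ n → + m - + n ≡ + p - + q
[+m]-[+n]≡[+p]-[+q] m n p q eq = begin
  + m - + n                 ≡⟨ add-both (+ m) (+ n) (+ q) ⟩
  (+ m + + q) - (+ n + + q) ≡⟨ cong (_- (+ n + + q)) (pos-+ m q) ⟨
  + (m ℕ.+ q) - (+ n + + q) ≡⟨ cong (λ x → + x - (+ n + + q)) eq ⟩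
  + (p ℕ.+ n) - (+ n + + q) ≡⟨ cong (_- (+ n + + q)) (pos-+ p n) ⟩
  (+ p + + n) - (+ n + + q) ≡⟨ cancel-n (+ p) (+ n) (+ q) ⟩
  + p - + q                 ∎
  where
  open ≡-Reasoning
  add-both : ∀ (a b c : ℤ) → a - b ≡ (a + c) - (b + c)
  add-both = ℤ-Solver.solve-∀
  cancel-n : ∀ (a b c : ℤ) → (a + b) - (b + c) ≡ a - c
  cancel-n = ℤ-Solver.solve-∀

-- diagonal a j = Σ_{t ≤ j} C(a + t, j − t): the part of the shallow diagonal
-- a + j of Pascal's triangle whose upper index is at least a.
diagonal : ℕ → ℕ → ℕ
diagonal a zero    = 1
diagonal a (suc j) = a C suc j ℕ.+ diagonal (suc a) j

diagonal-recurrence : ∀ a j → diagonal (suc a) (suc j) ≡ diagonal a j ℕ.+ diagonal a (suc j)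
diagonal-recurrence a zero = begin
  suc a C 1 ℕ.+ 1         ≡⟨ cong (ℕ._+ 1) (nCk+nC[k+1]≡[n+1]C[k+1] a 0) ⟨
  (1 ℕ.+ a C 1) ℕ.+ 1     ≡⟨ +-assoc 1 (a C 1) 1 ⟩
  1 ℕ.+ (a C 1 ℕ.+ 1)     ∎
  where open ≡-Reasoning
diagonal-recurrence a (suc j) = begin
  suc a C suc (suc j) ℕ.+ diagonal (suc (suc a)) (suc j)
    ≡⟨ cong₂ ℕ._+_ (sym (nCk+nC[k+1]≡[n+1]C[k+1] a (suc j))) (diagonal-recurrence (suc a) j) ⟩
  (a C suc j ℕ.+ a C suc (suc j)) ℕ.+ (diagonal (suc a) j ℕ.+ diagonal (suc a) (suc j))
    ≡⟨ interchange (a C suc j) (a C suc (suc j)) (diagonal (suc a) j) (diagonal (suc a) (suc j)) ⟩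
  (a C suc j ℕ.+ diagonal (suc a) j) ℕ.+ (a C suc (suc j) ℕ.+ diagonal (suc a) (suc j))
    ∎
  where open ≡-Reasoning

-- The bound a ≤ j + 1 says that the omitted part of the diagonal consists of zeros.
diagonal≡fib : ∀ a j → a ≤ suc j → diagonal a j ≡ fib (suc (a ℕ.+ j))
diagonal≡fib zero          zero    _            = refl
diagonal≡fib (suc zero)    zero    _            = refl
diagonal≡fib zero          (suc j) _            = diagonal≡fib 1 j (s≤s z≤n)
diagonal≡fib (suc a)       (suc j) (s≤s a≤1+j) = begin
  diagonal (suc a) (suc j)                        ≡⟨ diagonal-recurrence a j ⟩
  diagonal a j ℕ.+ diagonal a (suc j)             ≡⟨ cong₂ ℕ._+_ (diagonal≡fib a j a≤1+j)
                                                       (diagonal≡fib a (suc j) (m≤n⇒m≤1+n a≤1+j)) ⟩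
  fib (suc (a ℕ.+ j)) ℕ.+ fib (suc (a ℕ.+ suc j)) ≡⟨ +-comm (fib (suc (a ℕ.+ j))) _ ⟩
  fib (suc (a ℕ.+ suc j)) ℕ.+ fib (suc (a ℕ.+ j)) ≡⟨ cong (λ n → fib (suc (a ℕ.+ suc j)) ℕ.+ fib n) (+-suc a j) ⟨
  fib (suc (suc a ℕ.+ suc j))                     ∎
  where open ≡-Reasoning

diagonal-split : ∀ a m →
  diagonal a (suc m) ≡ a C suc m ℕ.+ sum (applyUpTo (λ i → (a ℕ.+ m ∸ i) C suc i) m) ℕ.+ 1
diagonal-split a zero    = cong (ℕ._+ 1) (sym (+-identityʳ (a C 1)))
diagonal-split a (suc m) = begin
  a C suc (suc m) ℕ.+ diagonal (suc a) (suc m)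
    ≡⟨ cong (a C suc (suc m) ℕ.+_) (diagonal-split (suc a) m) ⟩
  a C suc (suc m) ℕ.+ (suc a C suc m ℕ.+ interior (suc (a ℕ.+ m)) ℕ.+ 1)
    ≡⟨ rearrange (a C suc (suc m)) (suc a C suc m) (interior (suc (a ℕ.+ m))) ⟩
  a C suc (suc m) ℕ.+ (interior (suc (a ℕ.+ m)) ℕ.+ suc a C suc m) ℕ.+ 1
    ≡⟨ cong₂ (λ n b → a C suc (suc m) ℕ.+ (interior n ℕ.+ b C suc m) ℕ.+ 1)
             (+-suc a m) top-index ⟨
  a C suc (suc m) ℕ.+ (interior (a ℕ.+ suc m) ℕ.+ (a ℕ.+ suc m ∸ m) C suc m) ℕ.+ 1
    ≡⟨ cong (λ s → a C suc (suc m) ℕ.+ s ℕ.+ 1) (sum-applyUpTo-suc (λ i → (a ℕ.+ suc m ∸ i) C suc i) m) ⟨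
  a C suc (suc m) ℕ.+ sum (applyUpTo (λ i → (a ℕ.+ suc m ∸ i) C suc i) (suc m)) ℕ.+ 1
    ∎
  where
  open ≡-Reasoning
  interior : ℕ → ℕ
  interior n = sum (applyUpTo (λ i → (n ∸ i) C suc i) m)
  top-index : a ℕ.+ suc m ∸ m ≡ suc a
  top-index = trans (cong (_∸ m) (+-suc a m)) (m+n∸n≡m (suc a) m)
  rearrange : ∀ p q r → p ℕ.+ (q ℕ.+ r ℕ.+ 1) ≡ p ℕ.+ (r ℕ.+ q) ℕ.+ 1
  rearrange = ℕ-Solver.solve-∀

double : ∀ n → 2 * n ≡ n ℕ.+ n
double n = cong (n ℕ.+_) (+-identityʳ n)

sum[2k∸i]C[1+i]+1≡fib[2+2k] : ∀ k →
  sum (applyUpTo (λ i → (2 * k ∸ i) C suc i) k) ℕ.+ 1 ≡ fib (2 ℕ.+ 2 * k)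
sum[2k∸i]C[1+i]+1≡fib[2+2k] k = begin
  sum (applyUpTo (λ i → (2 * k ∸ i) C suc i) k) ℕ.+ 1
    ≡⟨ cong (λ n → sum (applyUpTo (λ i → (n ∸ i) C suc i) k) ℕ.+ 1) (double k) ⟩
  sum (applyUpTo (λ i → (k ℕ.+ k ∸ i) C suc i) k) ℕ.+ 1
    ≡⟨ cong (λ c → c ℕ.+ sum (applyUpTo (λ i → (k ℕ.+ k ∸ i) C suc i) k) ℕ.+ 1) (k>n⇒nCk≡0 (n<1+n k)) ⟨
  k C suc k ℕ.+ sum (applyUpTo (λ i → (k ℕ.+ k ∸ i) C suc i) k) ℕ.+ 1
    ≡⟨ diagonal-split k k ⟨
  diagonal k (suc k)
    ≡⟨ diagonal≡fib k (suc k) (m≤n⇒m≤1+n (n≤1+n k)) ⟩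
  fib (suc (k ℕ.+ suc k))
    ≡⟨ cong (λ n → fib (suc n)) (trans (+-suc k k) (cong suc (sym (double k)))) ⟩
  fib (2 ℕ.+ 2 * k)
    ∎
  where open ≡-Reasoning

sum[1+2k∸i]C[1+i]+2≡fib[3+2k] : ∀ k →
  sum (applyUpTo (λ i → suc (2 * k ∸ i) C suc i) k) ℕ.+ 2 ≡ fib (3 ℕ.+ 2 * k)
sum[1+2k∸i]C[1+i]+2≡fib[3+2k] k = begin
  sum (applyUpTo (λ i → suc (2 * k ∸ i) C suc i) k) ℕ.+ 2
    ≡⟨ cong (ℕ._+ 2) (sum-applyUpTo-cong k top-index) ⟩
  interior ℕ.+ 2
    ≡⟨ +-suc interior 1 ⟩
  1 ℕ.+ interior ℕ.+ 1
    ≡⟨ cong (λ c → c ℕ.+ interior ℕ.+ 1) (nCn≡1 (suc k)) ⟨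
  suc k C suc k ℕ.+ interior ℕ.+ 1
    ≡⟨ diagonal-split (suc k) k ⟨
  diagonal (suc k) (suc k)
    ≡⟨ diagonal≡fib (suc k) (suc k) (s≤s (n≤1+n k)) ⟩
  fib (suc (suc k ℕ.+ suc k))
    ≡⟨ cong (λ n → fib (suc (suc n))) (trans (+-suc k k) (cong suc (sym (double k)))) ⟩
  fib (3 ℕ.+ 2 * k)
    ∎
  where
  open ≡-Reasoning
  interior : ℕ
  interior = sum (applyUpTo (λ i → (suc k ℕ.+ k ∸ i) C suc i) k)
  top-index : ∀ {i} → i < k → suc (2 * k ∸ i) C suc i ≡ (suc k ℕ.+ k ∸ i) C suc i
  top-index {i} i<k = cong (_C suc i) (trans (sym (+-∸-assoc 1 i≤2k)) (cong (λ n → suc n ∸ i) (double k)))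
    where
    i≤2k : i ≤ 2 * k
    i≤2k = ≤-trans (<⇒≤ i<k) (m≤m+n k (k ℕ.+ 0))

fib-combination : ∀ s₁ s₂ n → s₁ ℕ.+ 2 ≡ fib (3 ℕ.+ n) → s₂ ℕ.+ 1 ≡ fib (2 ℕ.+ n) →
  + (2 * s₁) - + s₂ ≡ + (fib (2 ℕ.+ n) ℕ.+ 2 * fib (1 ℕ.+ n)) - + 3
fib-combination s₁ s₂ n h₁ h₂ = [+m]-[+n]≡[+p]-[+q] (2 * s₁) s₂ (F₂ ℕ.+ 2 * F₁) 3 (suc-injective (begin
  suc (2 * s₁ ℕ.+ 3)                   ≡⟨ double-shift s₁ ⟩
  2 * (s₁ ℕ.+ 2)                       ≡⟨ cong (2 *_) h₁ ⟩
  2 * (F₂ ℕ.+ F₁)                      ≡⟨ regroup F₁ F₂ ⟩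
  (F₂ ℕ.+ 2 * F₁) ℕ.+ F₂               ≡⟨ cong ((F₂ ℕ.+ 2 * F₁) ℕ.+_) h₂ ⟨
  (F₂ ℕ.+ 2 * F₁) ℕ.+ (s₂ ℕ.+ 1)       ≡⟨ trans (cong ((F₂ ℕ.+ 2 * F₁) ℕ.+_) (+-comm s₂ 1)) (+-suc _ s₂) ⟩
  suc ((F₂ ℕ.+ 2 * F₁) ℕ.+ s₂)         ∎))
  where
  open ≡-Reasoning
  F₁ = fib (1 ℕ.+ n)
  F₂ = fib (2 ℕ.+ n)
  double-shift : ∀ x → suc (2 * x ℕ.+ 3) ≡ 2 * (x ℕ.+ 2)
  double-shift = ℕ-Solver.solve-∀
  regroup : ∀ x y → 2 * (y ℕ.+ x) ≡ (y ℕ.+ 2 * x) ℕ.+ y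
  regroup = ℕ-Solver.solve-∀

mainTheorem5 : (k : ℕ) → Q k ≡ (+ fib (2 * k ℕ.+ 2) + + (2 * fib (2 * k ℕ.+ 1))) - + 3
mainTheorem5 k = begin
  Q k
    ≡⟨ sumℤ-map-difference (λ i → 2 * term₁ i) term₂ (upTo k) ⟩
  + sum (map (λ i → 2 * term₁ i) (upTo k)) - + sum (map term₂ (upTo k))
    ≡⟨ cong₂ (λ x y → + x - + y)
             (trans (sum-map-*ˡ 2 term₁ (upTo k)) (cong (λ xs → 2 * sum xs) (map-upTo term₁ k)))
             (cong sum (map-upTo term₂ k)) ⟩
  + (2 * S₁) - + S₂
    ≡⟨ fib-combination S₁ S₂ (2 * k) (sum[1+2k∸i]C[1+i]+2≡fib[3+2k] k) (sum[2k∸i]C[1+i]+1≡fib[2+2k] k) ⟩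
  + (fib (2 ℕ.+ 2 * k) ℕ.+ 2 * fib (1 ℕ.+ 2 * k)) - + 3
    ≡⟨ cong₂ (λ m n → + (fib m ℕ.+ 2 * fib n) - + 3) (+-comm 2 (2 * k)) (+-comm 1 (2 * k)) ⟩
  + (fib (2 * k ℕ.+ 2) ℕ.+ 2 * fib (2 * k ℕ.+ 1)) - + 3
    ≡⟨ cong (_- + 3) (pos-+ (fib (2 * k ℕ.+ 2)) (2 * fib (2 * k ℕ.+ 1))) ⟩
  (+ fib (2 * k ℕ.+ 2) + + (2 * fib (2 * k ℕ.+ 1))) - + 3
    ∎
  where
  open ≡-Reasoning
  term₁ term₂ : ℕ → ℕ
  term₁ i = suc (2 * k ∸ i) C suc i
  term₂ i = (2 * k ∸ i) C suc i
  S₁ S₂ : ℕ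
  S₁ = sum (applyUpTo term₁ k)
  S₂ = sum (applyUpTo term₂ k)
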